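{- Let $n$ be an even positive integer and let $S$ be the $n\times n$ Seidel matrix of a tournament $T$. Then there exists an $(n+2)\times(n+2)$ Seidel matrix (of some tournament of order $n+2$) whose determinant is strictly larger than $\det S$.
   Context: A tournament of order $n$ is a digraph on $\{1,\dots,n\}$ with exactly one of the arcs $ij$, $ji$ for each pair $i\ne j$. Its Seidel matrix $S=[s_{ij}]$ is the $n\times n$ skew-symmetric matrix with zero diagonal, $s_{ij}=1$ if $ij$ is an arc and $s_{ij}=-1$ otherwise. -}

module Defs where

open import Data.Nat using (ℕ; zero; suc)
open import Data.Integer using (ℤ; +_; -_; _+_; _*_; -1ℤ; 0ℤ; 1ℤ)
open import Data.Fin using (Fin; zero; suc; punchIn)
open import Data.Bool using (Bool; true; false; T; not)
open import Relation.Binary.PropositionalEquality using (_≡_; _≢_)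
open import Relation.Nullary using (yes; no)
open import Data.Fin using (_≟_)

Matrix : ℕ → Set
Matrix n = Fin n → Fin n → ℤ

minor : ∀ {n} → Matrix (suc n) → Fin (suc n) → Matrix n
minor M j r c = M (suc r) (punchIn j c)

sumFin : ∀ {n} → (Fin n → ℤ) → ℤ
sumFin {zero} f = 0ℤ
sumFin {suc n} f = f zero + sumFin (λ i → f (suc i))

signFin : ∀ {n} → Fin n → ℤ
signFin zero = 1ℤ
signFin (suc j) = - signFin j

det : ∀ {n} → Matrix n → ℤ
det {zero} M = 1ℤ
det {suc n} M = sumFin (λ j → signFin j * (M zero j * det (minor M j)))

record Tournament (n : ℕ) : Set where
  field
    arc : Fin n → Fin n → Bool
    irrefl : ∀ i → arc i i ≡ false
    tourn : ∀ i j → i ≢ j → arc j i ≡ not (arc i j)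

open Tournament public

seidel : ∀ {n} → Tournament n → Matrix n
seidel T i j with i ≟ j
... | yes _ = 0ℤ
... | no _ with arc T i j
...   | true = 1ℤ
...   | false = -1ℤ

{-# OPTIONS --safe #-}
-- The Seidel matrix of a tournament of even order is skew-symmetric with odd
-- off-diagonal entries, and such a matrix A has positive determinant: pivoting
-- on a 2 × 2 block [[0, c], [-c, 0]] gives c ^ (n - 2) · det A = c² · det A₁,
-- where c is odd, hence non-zero, and A₁ is again skew-symmetric with odd
-- off-diagonal entries, of order n - 2.
-- Adding two suitable vertices p → q to a tournament with Seidel matrix S, the
-- pivot block on {p, q} has c = 1 and A₁ is S with row and column 0 tripled, so
-- the new determinant is 9 · det S > det S.
module Submission where

open import Defs

module Determinant where

  open import Data.Nat.Base using (ℕ; zero; suc)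
  open import Data.Fin.Base using (Fin; zero; suc; punchIn; punchOut)
  open import Data.Fin.Properties using (_≟_; punchInᵢ≢i; punchOut-cong; punchOut-punchIn)
  open import Data.Integer.Base using (ℤ; +_; -_; _+_; _-_; _*_; 0ℤ; 1ℤ; -1ℤ)
  open import Data.Integer.Properties
    using (+-*-semiring; -1*i≡-i; +-identityˡ; neg-involutive; *-cancelʳ-≡; +-inverseʳ)
  open import Data.Integer.Tactic.RingSolver using (solve-∀)
  open import Algebra.Properties.Semiring.Sum +-*-semiring
    using (sum; sum-cong-≗; sum-remove; sum-replicate-zero; ∑-comm; ∑-distrib-+; *-distribˡ-sum)
  open import Data.Vec.Functional using (_∷_)
  open import Function.Base using (_∘_)
  open import Relation.Binary.PropositionalEquality
  open import Relation.Nullary using (yes; no)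
  open import Relation.Nullary.Negation using (contradiction)
  open ≡-Reasoning

  private variable n : ℕ

  x≡-x⇒x≡0 : {x : ℤ} → x ≡ - x → x ≡ 0ℤ
  x≡-x⇒x≡0 {x} x≡-x = *-cancelʳ-≡ x 0ℤ (+ 2) (begin
    x * + 2  ≡⟨ double x ⟩
    x + x    ≡⟨ cong (_+_ x) x≡-x ⟩
    x + - x  ≡⟨ +-inverseʳ x ⟩
    0ℤ       ∎)
    where double : ∀ x → x * + 2 ≡ x + x
          double = solve-∀

  sumFin≡sum : (f : Fin n → ℤ) → sumFin f ≡ sum f
  sumFin≡sum {zero}  f = refl
  sumFin≡sum {suc n} f = cong (_+_ (f zero)) (sumFin≡sum (f ∘ suc))

  sum-zero : {f : Fin n → ℤ} → (∀ i → f i ≡ 0ℤ) → sum f ≡ 0ℤ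
  sum-zero {n} f≗0 = trans (sum-cong-≗ f≗0) (sum-replicate-zero n)

  sum-neg : (f : Fin n → ℤ) → sum (λ i → - f i) ≡ - sum f
  sum-neg f = begin
    sum (λ i → - f i)      ≡⟨ sum-cong-≗ (λ i → -1*i≡-i (f i)) ⟨
    sum (λ i → -1ℤ * f i)  ≡⟨ *-distribˡ-sum -1ℤ f ⟨
    -1ℤ * sum f            ≡⟨ -1*i≡-i (sum f) ⟩
    - sum f                ∎

  -- The determinant of M with its first row replaced by v.
  cofactorExpansion : Matrix (suc n) → (Fin (suc n) → ℤ) → ℤ
  cofactorExpansion M v = sum λ j → signFin j * (v j * det (minor M j))

  det-expansion : (M : Matrix (suc n)) → det M ≡ cofactorExpansion M (M zero)
  det-expansion M = sumFin≡sum λ j → signFin j * (M zero j * det (minor M j))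

  det-cong : {M N : Matrix n} → (∀ i j → M i j ≡ N i j) → det M ≡ det N
  det-cong {zero}  _ = refl
  det-cong {suc n} {M} {N} M≗N = begin
    det M                         ≡⟨ det-expansion M ⟩
    cofactorExpansion M (M zero)  ≡⟨ sum-cong-≗ term ⟩
    cofactorExpansion N (N zero)  ≡⟨ det-expansion N ⟨
    det N                         ∎
    where
      term : ∀ j → signFin j * (M zero j * det (minor M j)) ≡ signFin j * (N zero j * det (minor N j))
      term j = cong₂ (λ x d → signFin j * (x * d)) (M≗N zero j) (det-cong λ r c → M≗N (suc r) (punchIn j c))

  det₂ : (A : Matrix 2) → det A ≡ A zero zero * A (suc zero) (suc zero) - A zero (suc zero) * A (suc zero) zero
  det₂ A = expand (A zero zero) (A zero (suc zero)) (A (suc zero) zero) (A (suc zero) (suc zero))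
    where
      -- The left-hand side is the normal form of det A.
      expand : ∀ a b c d →
        1ℤ * (a * (1ℤ * (d * 1ℤ) + 0ℤ)) + (-1ℤ * (b * (1ℤ * (c * 1ℤ) + 0ℤ)) + 0ℤ) ≡ a * d - b * c
      expand = solve-∀

  cofactorExpansion-+ : (M : Matrix (suc n)) (u v : Fin (suc n) → ℤ) →
    cofactorExpansion M (λ j → u j + v j) ≡ cofactorExpansion M u + cofactorExpansion M v
  cofactorExpansion-+ M u v =
    trans (sum-cong-≗ λ j → distrib (signFin j) (u j) (v j) (det (minor M j))) (∑-distrib-+ (summand u) (summand v))
    where
      summand : (Fin (suc _) → ℤ) → Fin (suc _) → ℤ
      summand w j = signFin j * (w j * det (minor M j))
      distrib : ∀ s a b d → s * ((a + b) * d) ≡ s * (a * d) + s * (b * d)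
      distrib = solve-∀

  cofactorExpansion-* : (M : Matrix (suc n)) (x : ℤ) (u : Fin (suc n) → ℤ) →
    cofactorExpansion M (λ j → x * u j) ≡ x * cofactorExpansion M u
  cofactorExpansion-* M x u =
    trans (sum-cong-≗ λ j → pull (signFin j) x (u j) (det (minor M j)))
          (sym (*-distribˡ-sum x λ j → signFin j * (u j * det (minor M j))))
    where pull : ∀ s x a d → s * ((x * a) * d) ≡ x * (s * (a * d))
          pull = solve-∀

  punchIn-punchOut-comm : {a b : Fin (suc (suc n))} (a≢b : a ≢ b) (b≢a : b ≢ a) (c : Fin n) →
    punchIn a (punchIn (punchOut a≢b) c) ≡ punchIn b (punchIn (punchOut b≢a) c)
  punchIn-punchOut-comm {a = zero} {zero} a≢b _ _ = contradiction refl a≢b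
  punchIn-punchOut-comm {suc n} {zero} {suc b} _ _ _ = refl
  punchIn-punchOut-comm {suc n} {suc a} {zero} _ _ _ = refl
  punchIn-punchOut-comm {suc n} {suc a} {suc b} _ _ zero = refl
  punchIn-punchOut-comm {suc n} {suc a} {suc b} a≢b b≢a (suc c) =
    cong suc (punchIn-punchOut-comm (a≢b ∘ cong suc) (b≢a ∘ cong suc) c)

  signFin-punchOut-anti : {a b : Fin (suc (suc n))} (a≢b : a ≢ b) (b≢a : b ≢ a) →
    signFin b * signFin (punchOut b≢a) ≡ - (signFin a * signFin (punchOut a≢b))
  signFin-punchOut-anti {a = zero} {zero} a≢b _ = contradiction refl a≢b
  signFin-punchOut-anti {a = zero} {suc b} _ _ = lemma (signFin b)
    where lemma : ∀ s → (- s) * 1ℤ ≡ - (1ℤ * s)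
          lemma = solve-∀
  signFin-punchOut-anti {a = suc a} {zero} _ _ = lemma (signFin a)
    where lemma : ∀ s → 1ℤ * s ≡ - ((- s) * 1ℤ)
          lemma = solve-∀
  signFin-punchOut-anti {zero} {suc zero} {suc zero} a≢b _ = contradiction refl a≢b
  signFin-punchOut-anti {suc n} {suc a} {suc b} a≢b b≢a = begin
    (- signFin b) * (- signFin (punchOut b′≢a′))  ≡⟨ neg-*-neg (signFin b) _ ⟩
    signFin b * signFin (punchOut b′≢a′)          ≡⟨ signFin-punchOut-anti a′≢b′ b′≢a′ ⟩
    - (signFin a * signFin (punchOut a′≢b′))      ≡⟨ cong -_ (neg-*-neg (signFin a) _) ⟨
    - ((- signFin a) * (- signFin (punchOut a′≢b′))) ∎
    where
      a′≢b′ = a≢b ∘ cong suc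
      b′≢a′ = b≢a ∘ cong suc
      neg-*-neg : ∀ x y → (- x) * (- y) ≡ x * y
      neg-*-neg = solve-∀

  module TwoRowExpansion (M : Matrix (suc (suc n))) where

    complementaryMinor : {a b : Fin (suc (suc n))} → a ≢ b → ℤ
    complementaryMinor {a} a≢b = det (minor (minor M a) (punchOut a≢b))

    complementaryMinor-comm : {a b : Fin (suc (suc n))} (a≢b : a ≢ b) (b≢a : b ≢ a) →
      complementaryMinor a≢b ≡ complementaryMinor b≢a
    complementaryMinor-comm a≢b b≢a =
      det-cong λ r c → cong (M (suc (suc r))) (punchIn-punchOut-comm a≢b b≢a c)

    term : Fin (suc (suc n)) → Fin (suc (suc n)) → ℤ
    term a b with a ≟ b
    ... | yes _   = 0ℤ
    ... | no a≢b = signFin a * signFin (punchOut a≢b) * (M zero a * M (suc zero) b) * complementaryMinor a≢b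

    term-diag : ∀ a → term a a ≡ 0ℤ
    term-diag a with a ≟ a
    ... | yes _   = refl
    ... | no a≢a = contradiction refl a≢a

    term-punchIn : ∀ a l →
      term a (punchIn a l) ≡ signFin a * signFin l * (M zero a * M (suc zero) (punchIn a l)) * det (minor (minor M a) l)
    term-punchIn a l with a ≟ punchIn a l
    ... | yes a≡ = contradiction (sym a≡) (punchInᵢ≢i a l)
    ... | no a≢ rewrite trans (punchOut-cong a {i≢j = a≢} refl) (punchOut-punchIn a {l}) = refl

    rowExpansion : ∀ a → signFin a * (M zero a * det (minor M a)) ≡ sum (term a)
    rowExpansion a = begin
      signFin a * (M zero a * det (minor M a))
        ≡⟨ cong (λ d → signFin a * (M zero a * d)) (det-expansion (minor M a)) ⟩
      signFin a * (M zero a * sum f)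
        ≡⟨ lemma (signFin a) (M zero a) (sum f) ⟩
      (signFin a * M zero a) * sum f
        ≡⟨ *-distribˡ-sum (signFin a * M zero a) f ⟩
      sum (λ l → (signFin a * M zero a) * f l)
        ≡⟨ sum-cong-≗ (λ l → trans (rearrange (signFin a) (M zero a) (signFin l) _ _) (sym (term-punchIn a l))) ⟩
      sum (term a ∘ punchIn a)
        ≡⟨ +-identityˡ _ ⟨
      0ℤ + sum (term a ∘ punchIn a)
        ≡⟨ cong (_+ sum (term a ∘ punchIn a)) (term-diag a) ⟨
      term a a + sum (term a ∘ punchIn a)
        ≡⟨ sum-remove {i = a} (term a) ⟨
      sum (term a) ∎
      where
        f : Fin (suc n) → ℤ
        f l = signFin l * (M (suc zero) (punchIn a l) * det (minor (minor M a) l))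
        lemma : ∀ s x y → s * (x * y) ≡ (s * x) * y
        lemma = solve-∀
        rearrange : ∀ s x t y d → (s * x) * (t * (y * d)) ≡ s * t * (x * y) * d
        rearrange = solve-∀

    expansion : det M ≡ sum λ a → sum (term a)
    expansion = trans (det-expansion M) (sum-cong-≗ rowExpansion)

  swapRows₀₁ : Matrix (suc (suc n)) → Matrix (suc (suc n))
  swapRows₀₁ M = M (suc zero) ∷ M zero ∷ λ r → M (suc (suc r))

  open TwoRowExpansion using (term; complementaryMinor; complementaryMinor-comm)

  term-swapRows₀₁ : (M : Matrix (suc (suc n))) (a b : Fin (suc (suc n))) →
    term (swapRows₀₁ M) a b ≡ - term M b a
  term-swapRows₀₁ M a b with a ≟ b | b ≟ a
  ... | yes _    | yes _    = refl
  ... | yes refl | no b≢a  = contradiction refl b≢a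
  ... | no a≢b  | yes refl = contradiction refl a≢b
  ... | no a≢b  | no b≢a  = begin
    σ * (M (suc zero) a * M zero b) * D
      ≡⟨ lemma σ (M (suc zero) a) (M zero b) D ⟩
    - ((- σ) * (M zero b * M (suc zero) a) * D)
      ≡⟨ cong₂ (λ s d → - (s * (M zero b * M (suc zero) a) * d))
               (sym (signFin-punchOut-anti a≢b b≢a)) (complementaryMinor-comm M a≢b b≢a) ⟩
    - (signFin b * signFin (punchOut b≢a) * (M zero b * M (suc zero) a) * complementaryMinor M b≢a) ∎
    where
      σ = signFin a * signFin (punchOut a≢b)
      D = complementaryMinor M a≢b
      lemma : ∀ s x y d → s * (x * y) * d ≡ - ((- s) * (y * x) * d)
      lemma = solve-∀

  det-swapRows₀₁ : (M : Matrix (suc (suc n))) → det (swapRows₀₁ M) ≡ - det M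
  det-swapRows₀₁ M = begin
    det (swapRows₀₁ M)                                ≡⟨ TwoRowExpansion.expansion (swapRows₀₁ M) ⟩
    sum (λ a → sum λ b → term (swapRows₀₁ M) a b)    ≡⟨ sum-cong-≗ (sum-cong-≗ ∘ term-swapRows₀₁ M) ⟩
    sum (λ a → sum λ b → - term M b a)               ≡⟨ sum-cong-≗ (λ a → sum-neg (λ b → term M b a)) ⟩
    sum (λ a → - sum λ b → term M b a)               ≡⟨ sum-neg (λ a → sum λ b → term M b a) ⟩
    - sum (λ a → sum λ b → term M b a)               ≡⟨ cong -_ (∑-comm (λ a b → term M b a)) ⟩
    - sum (λ b → sum λ a → term M b a)               ≡⟨ cong -_ (TwoRowExpansion.expansion M) ⟨
    - det M                                          ∎

  det-repeatedRow₀ : (M : Matrix (suc n)) (i : Fin n) → (∀ c → M zero c ≡ M (suc i) c) → det M ≡ 0ℤ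
  det-repeatedRow₀ M zero row₀≗row₁ = x≡-x⇒x≡0 (begin
    det M               ≡⟨ det-cong swap≗ ⟩
    det (swapRows₀₁ M)  ≡⟨ det-swapRows₀₁ M ⟩
    - det M             ∎)
    where
      swap≗ : ∀ r c → M r c ≡ swapRows₀₁ M r c
      swap≗ zero          c = row₀≗row₁ c
      swap≗ (suc zero)    c = sym (row₀≗row₁ c)
      swap≗ (suc (suc r)) c = refl
  -- After swapping rows 0 and 1 the repeated row lies in every minor of the first row.
  det-repeatedRow₀ {suc n} M (suc i) row₀≗row = begin
    det M                   ≡⟨ neg-involutive (det M) ⟨
    - - det M               ≡⟨ cong -_ (det-swapRows₀₁ M) ⟨
    - det (swapRows₀₁ M)    ≡⟨ cong -_ (trans (det-expansion (swapRows₀₁ M)) (sum-zero summand)) ⟩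
    - 0ℤ                    ∎
    where
      summand : ∀ j → signFin j * (M (suc zero) j * det (minor (swapRows₀₁ M) j)) ≡ 0ℤ
      summand j rewrite det-repeatedRow₀ (minor (swapRows₀₁ M) j) i (λ c → row₀≗row (punchIn j c)) =
        zeroʳ (signFin j) (M (suc zero) j)
        where zeroʳ : ∀ s x → s * (x * 0ℤ) ≡ 0ℤ
              zeroʳ = solve-∀

  cofactorExpansion-repeatedRow : (M : Matrix (suc n)) (i : Fin n) → cofactorExpansion M (M (suc i)) ≡ 0ℤ
  cofactorExpansion-repeatedRow M i =
    trans (sym (det-expansion N)) (det-repeatedRow₀ N i λ _ → refl)
    where N = M (suc i) ∷ λ r → M (suc r)

  cofactorExpansion-rowOp : (M : Matrix (suc n)) (x a b : ℤ) (i k : Fin n) →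
    cofactorExpansion M (λ j → x * M zero j + a * M (suc i) j + b * M (suc k) j) ≡ x * det M
  cofactorExpansion-rowOp {n} M x a b i k = begin
    E (λ j → u j + v j + w j)
      ≡⟨ cofactorExpansion-+ M (λ j → u j + v j) w ⟩
    E (λ j → u j + v j) + E w
      ≡⟨ cong (_+ E w) (cofactorExpansion-+ M u v) ⟩
    E u + E v + E w
      ≡⟨ cong₂ _+_ (cong₂ _+_ (cofactorExpansion-* M x (M zero)) (cofactorExpansion-* M a (M (suc i))))
                   (cofactorExpansion-* M b (M (suc k))) ⟩
    x * E (M zero) + a * E (M (suc i)) + b * E (M (suc k))
      ≡⟨ cong₂ _+_ (cong₂ _+_ (cong (x *_) (sym (det-expansion M)))
                              (cong (a *_) (cofactorExpansion-repeatedRow M i)))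
                   (cong (b *_) (cofactorExpansion-repeatedRow M k)) ⟩
    x * det M + a * 0ℤ + b * 0ℤ
      ≡⟨ lemma x (det M) a b ⟩
    x * det M ∎
    where
      E = cofactorExpansion M
      u v w : Fin (suc n) → ℤ
      u j = x * M zero j
      v j = a * M (suc i) j
      w j = b * M (suc k) j
      lemma : ∀ x d a b → x * d + a * 0ℤ + b * 0ℤ ≡ x * d
      lemma = solve-∀

  det-scaleRow₀ : (x : ℤ) {M N : Matrix (suc n)} → (∀ j → M zero j ≡ x * N zero j) →
    (∀ r j → M (suc r) j ≡ N (suc r) j) → det M ≡ x * det N
  det-scaleRow₀ x {M} {N} row₀ rows = begin
    det M                                     ≡⟨ det-expansion M ⟩
    cofactorExpansion M (M zero)              ≡⟨ sum-cong-≗ summand ⟩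
    cofactorExpansion N (λ j → x * N zero j)  ≡⟨ cofactorExpansion-* N x (N zero) ⟩
    x * cofactorExpansion N (N zero)          ≡⟨ cong (x *_) (det-expansion N) ⟨
    x * det N                                 ∎
    where
      summand : ∀ j → signFin j * (M zero j * det (minor M j)) ≡ signFin j * (x * N zero j * det (minor N j))
      summand j = cong₂ (λ y d → signFin j * (y * d)) (row₀ j) (det-cong λ r c → rows r (punchIn j c))

  mutual
    det-scaleCol₀ : (x : ℤ) {M N : Matrix (suc n)} → (∀ i → M i zero ≡ x * N i zero) →
      (∀ i j → M i (suc j) ≡ N i (suc j)) → det M ≡ x * det N
    det-scaleCol₀ x {M} {N} col₀ cols = begin
      det M                                       ≡⟨ det-expansion M ⟩
      cofactorExpansion M (M zero)                ≡⟨ sum-cong-≗ (det-scaleCol₀-summand x {M} {N} col₀ cols) ⟩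
      sum (λ j → x * summand j)                   ≡⟨ *-distribˡ-sum x summand ⟨
      x * cofactorExpansion N (N zero)            ≡⟨ cong (x *_) (det-expansion N) ⟨
      x * det N                                   ∎
      where
        summand : Fin (suc _) → ℤ
        summand j = signFin j * (N zero j * det (minor N j))

    det-scaleCol₀-summand : (x : ℤ) {M N : Matrix (suc n)} → (∀ i → M i zero ≡ x * N i zero) →
      (∀ i j → M i (suc j) ≡ N i (suc j)) →
      ∀ j → signFin j * (M zero j * det (minor M j)) ≡ x * (signFin j * (N zero j * det (minor N j)))
    det-scaleCol₀-summand x {M} {N} col₀ cols zero = begin
      1ℤ * (M zero zero * det (minor M zero))
        ≡⟨ cong₂ (λ y d → 1ℤ * (y * d)) (col₀ zero) (det-cong λ r c → cols (suc r) c) ⟩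
      1ℤ * (x * N zero zero * det (minor N zero))
        ≡⟨ lemma x (N zero zero) (det (minor N zero)) ⟩
      x * (1ℤ * (N zero zero * det (minor N zero))) ∎
      where lemma : ∀ x y d → 1ℤ * (x * y * d) ≡ x * (1ℤ * (y * d))
            lemma = solve-∀
    det-scaleCol₀-summand {suc n} x {M} {N} col₀ cols (suc j) = begin
      s * (M zero (suc j) * det (minor M (suc j)))
        ≡⟨ cong₂ (λ y d → s * (y * d)) (cols zero j)
                 (det-scaleCol₀ x {minor M (suc j)} {minor N (suc j)}
                                (λ r → col₀ (suc r)) (λ r c → cols (suc r) (punchIn j c))) ⟩
      s * (N zero (suc j) * (x * det (minor N (suc j))))
        ≡⟨ lemma s x (N zero (suc j)) (det (minor N (suc j))) ⟩
      x * (s * (N zero (suc j) * det (minor N (suc j)))) ∎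
      where s = signFin (suc j)
            lemma : ∀ s x y d → s * (y * (x * d)) ≡ x * (s * (y * d))
            lemma = solve-∀

module SchurComplement where

  open Determinant
  open import Data.Nat.Base using (ℕ; zero; suc)
  open import Data.Fin.Base using (Fin; zero; suc; punchIn; inject₁; fromℕ)
  open import Data.Fin.Properties using (inject₁-injective; fromℕ≢inject₁)
  open import Data.Integer.Base using (ℤ; -_; _+_; _*_; _-_; _^_; 0ℤ; 1ℤ)
  open import Data.Integer.Properties using (+-*-semiring; +-identityʳ; *-identityˡ; *-zeroʳ)
  open import Data.Integer.Tactic.RingSolver using (solve-∀)
  open import Algebra.Properties.Semiring.Sum +-*-semiring
    using (sum; sum-cong-≗; sum-init-last; *-distribˡ-sum)
  open import Function.Base using (_∘_)
  open import Relation.Binary.PropositionalEquality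
  open ≡-Reasoning

  private variable n m : ℕ

  inject₂ : Fin m → Fin (suc (suc m))
  inject₂ i = inject₁ (inject₁ i)

  pivot₀ pivot₁ : Fin (suc (suc m))
  pivot₀ {m} = inject₁ (fromℕ m)
  pivot₁ {m} = fromℕ (suc m)

  inject₂-injective : {i j : Fin m} → inject₂ i ≡ inject₂ j → i ≡ j
  inject₂-injective = inject₁-injective ∘ inject₁-injective

  pivot₀≢pivot₁ : pivot₀ {m} ≢ pivot₁
  pivot₀≢pivot₁ = fromℕ≢inject₁ ∘ sym

  inject₂≢pivot₀ : (i : Fin m) → inject₂ i ≢ pivot₀
  inject₂≢pivot₀ i = fromℕ≢inject₁ ∘ sym ∘ inject₁-injective

  inject₂≢pivot₁ : (i : Fin m) → inject₂ i ≢ pivot₁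
  inject₂≢pivot₁ i = fromℕ≢inject₁ ∘ sym

  signFin-inject₁ : (i : Fin n) → signFin (inject₁ i) ≡ signFin i
  signFin-inject₁ zero    = refl
  signFin-inject₁ (suc i) = cong -_ (signFin-inject₁ i)

  punchIn-inject₁ : (i : Fin (suc n)) (j : Fin n) → punchIn (inject₁ i) (inject₁ j) ≡ inject₁ (punchIn i j)
  punchIn-inject₁ zero    j       = refl
  punchIn-inject₁ (suc i) zero    = refl
  punchIn-inject₁ (suc i) (suc j) = cong suc (punchIn-inject₁ i j)

  punchIn-inject₁-fromℕ : (i : Fin (suc n)) → punchIn (inject₁ i) (fromℕ n) ≡ fromℕ (suc n)
  punchIn-inject₁-fromℕ zero            = refl
  punchIn-inject₁-fromℕ {suc n} (suc i) = cong suc (punchIn-inject₁-fromℕ i)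

  punchIn-inject₂ : (s : Fin (suc m)) (c : Fin m) → punchIn (inject₂ s) (inject₂ c) ≡ inject₂ (punchIn s c)
  punchIn-inject₂ s c = trans (punchIn-inject₁ (inject₁ s) (inject₁ c)) (cong inject₁ (punchIn-inject₁ s c))

  punchIn-inject₂-pivot₀ : (s : Fin (suc m)) → punchIn (inject₂ s) pivot₀ ≡ pivot₀
  punchIn-inject₂-pivot₀ {m} s =
    trans (punchIn-inject₁ (inject₁ s) (fromℕ m)) (cong inject₁ (punchIn-inject₁-fromℕ s))

  punchIn-inject₂-pivot₁ : (s : Fin (suc m)) → punchIn (inject₂ s) pivot₁ ≡ pivot₁
  punchIn-inject₂-pivot₁ s = punchIn-inject₁-fromℕ (inject₁ s)

  sum-inject₂ : (f : Fin (suc (suc m)) → ℤ) → f pivot₀ ≡ 0ℤ → f pivot₁ ≡ 0ℤ →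
    sum f ≡ sum (f ∘ inject₂)
  sum-inject₂ f f₀ f₁ = begin
    sum f                                    ≡⟨ sum-init-last f ⟩
    sum (f ∘ inject₁) + f pivot₁             ≡⟨ cong (_+ f pivot₁) (sum-init-last (f ∘ inject₁)) ⟩
    sum (f ∘ inject₂) + f pivot₀ + f pivot₁  ≡⟨ cong₂ (λ x y → sum (f ∘ inject₂) + x + y) f₀ f₁ ⟩
    sum (f ∘ inject₂) + 0ℤ + 0ℤ              ≡⟨ trans (+-identityʳ _) (+-identityʳ _) ⟩
    sum (f ∘ inject₂)                        ∎

  record SkewPivot (A : Matrix (suc (suc m))) : Set where
    field
      zero₀ : A pivot₀ pivot₀ ≡ 0ℤ
      zero₁ : A pivot₁ pivot₁ ≡ 0ℤ
      anti  : A pivot₁ pivot₀ ≡ - A pivot₀ pivot₁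

  -- c times row x, minus the combination of the pivot rows that clears the pivot
  -- columns; on the other indices this is c · (A₁₁ - A₁₂ A₂₂⁻¹ A₂₁) for the pivot
  -- block A₂₂ = [[0, c], [-c, 0]], which is integral.
  reduce : Matrix (suc (suc m)) → Fin (suc (suc m)) → Fin (suc (suc m)) → ℤ
  reduce A x y = A pivot₀ pivot₁ * A x y + (- A x pivot₁) * A pivot₀ y + A x pivot₀ * A pivot₁ y

  schurComplement : Matrix (suc (suc m)) → Matrix m
  schurComplement A r s = reduce A (inject₂ r) (inject₂ s)

  module _ {A : Matrix (suc (suc m))} (P : SkewPivot A) where
    open SkewPivot P

    private
      c = A pivot₀ pivot₁

    reduce-pivot₀ : ∀ x → reduce A x pivot₀ ≡ 0ℤ
    reduce-pivot₀ x =
      trans (cong₂ (λ u v → c * A x pivot₀ + (- A x pivot₁) * u + A x pivot₀ * v) zero₀ anti)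
            (lemma c (A x pivot₀) (A x pivot₁))
      where lemma : ∀ c a b → c * a + (- b) * 0ℤ + a * (- c) ≡ 0ℤ
            lemma = solve-∀

    reduce-pivot₁ : ∀ x → reduce A x pivot₁ ≡ 0ℤ
    reduce-pivot₁ x =
      trans (cong (λ u → c * A x pivot₁ + (- A x pivot₁) * c + A x pivot₀ * u) zero₁)
            (lemma c (A x pivot₀) (A x pivot₁))
      where lemma : ∀ c a b → c * b + (- b) * c + a * 0ℤ ≡ 0ℤ
            lemma = solve-∀

  module _ {A : Matrix (suc (suc (suc m)))} (s : Fin (suc m)) where

    skewPivot-minor : SkewPivot A → SkewPivot (minor A (inject₂ s))
    skewPivot-minor P = record
      { zero₀ = trans (cong (A pivot₀) (punchIn-inject₂-pivot₀ s)) zero₀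
      ; zero₁ = trans (cong (A pivot₁) (punchIn-inject₂-pivot₁ s)) zero₁
      ; anti  = trans (cong (A pivot₁) (punchIn-inject₂-pivot₀ s))
                      (trans anti (cong -_ (sym (cong (A pivot₀) (punchIn-inject₂-pivot₁ s)))))
      }
      where open SkewPivot P

    schurComplement-minor : ∀ r t → schurComplement (minor A (inject₂ s)) r t ≡ minor (schurComplement A) s r t
    schurComplement-minor r t
      rewrite punchIn-inject₂-pivot₀ s | punchIn-inject₂-pivot₁ s | punchIn-inject₂ s t = refl

  cofactorExpansion-inject₂ : (A : Matrix (suc (suc m))) (v : Fin (suc (suc m)) → ℤ) →
    v pivot₀ ≡ 0ℤ → v pivot₁ ≡ 0ℤ →
    cofactorExpansion A v ≡ sum λ s → signFin s * (v (inject₂ s) * det (minor A (inject₂ s)))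
  cofactorExpansion-inject₂ A v v₀ v₁ = begin
    sum f              ≡⟨ sum-inject₂ f (vanishes v₀) (vanishes v₁) ⟩
    sum (f ∘ inject₂)
      ≡⟨ sum-cong-≗ (λ s → cong (_* (v (inject₂ s) * det (minor A (inject₂ s)))) (signFin-inject₂ s)) ⟩
    sum (λ s → signFin s * (v (inject₂ s) * det (minor A (inject₂ s)))) ∎
    where
      f : Fin (suc (suc _)) → ℤ
      f j = signFin j * (v j * det (minor A j))
      vanishes : ∀ {j} → v j ≡ 0ℤ → f j ≡ 0ℤ
      vanishes {j} v≡0 = trans (cong (λ x → signFin j * (x * det (minor A j))) v≡0) (*-zeroʳ (signFin j))
      signFin-inject₂ : ∀ s → signFin (inject₂ s) ≡ signFin s
      signFin-inject₂ s = trans (signFin-inject₁ (inject₁ s)) (signFin-inject₁ s)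

  eliminateRow₀ : (A : Matrix (suc (suc (suc m)))) → SkewPivot A →
    A pivot₀ pivot₁ * det A ≡ sum λ s → signFin s * (schurComplement A zero s * det (minor A (inject₂ s)))
  eliminateRow₀ A P = begin
    A pivot₀ pivot₁ * det A
      ≡⟨ cofactorExpansion-rowOp A (A pivot₀ pivot₁) (- A zero pivot₁) (A zero pivot₀) pivot₀ pivot₁ ⟨
    cofactorExpansion A (reduce A zero)
      ≡⟨ cofactorExpansion-inject₂ A (reduce A zero) (reduce-pivot₀ P zero) (reduce-pivot₁ P zero) ⟩
    sum (λ s → signFin s * (schurComplement A zero s * det (minor A (inject₂ s)))) ∎

  det-schur : (A : Matrix (suc (suc m))) → SkewPivot A →
    A pivot₀ pivot₁ ^ m * det A ≡ A pivot₀ pivot₁ * A pivot₀ pivot₁ * det (schurComplement A)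
  det-schur {zero} A P = begin
    1ℤ * det A                                               ≡⟨ *-identityˡ (det A) ⟩
    det A                                                    ≡⟨ det₂ A ⟩
    A pivot₀ pivot₀ * A pivot₁ pivot₁ - c * A pivot₁ pivot₀
      ≡⟨ cong₂ (λ u v → u - c * v) (cong₂ _*_ zero₀ zero₁) anti ⟩
    0ℤ * 0ℤ - c * (- c)                                      ≡⟨ lemma c ⟩
    c * c * 1ℤ                                               ∎
    where
      open SkewPivot P
      c = A pivot₀ pivot₁
      lemma : ∀ c → 0ℤ * 0ℤ - c * (- c) ≡ c * c * 1ℤ
      lemma = solve-∀
  det-schur {suc m} A P = begin
    c ^ suc m * det A                              ≡⟨ lemma c (c ^ m) (det A) ⟩
    c ^ m * (c * det A)                            ≡⟨ cong (c ^ m *_) (eliminateRow₀ A P) ⟩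
    c ^ m * sum (λ s → term s (detMinor s))          ≡⟨ *-distribˡ-sum (c ^ m) (λ s → term s (detMinor s)) ⟩
    sum (λ s → c ^ m * term s (detMinor s))          ≡⟨ sum-cong-≗ column ⟩
    sum (λ s → c * c * term s (det (minor B s)))   ≡⟨ *-distribˡ-sum (c * c) (λ s → term s (det (minor B s))) ⟨
    c * c * cofactorExpansion B (B zero)           ≡⟨ cong (c * c *_) (det-expansion B) ⟨
    c * c * det B                                  ∎
    where
      c = A pivot₀ pivot₁
      B = schurComplement A
      term : Fin (suc m) → ℤ → ℤ
      term s d = signFin s * (B zero s * d)
      detMinor : Fin (suc m) → ℤ
      detMinor s = det (minor A (inject₂ s))
      lemma : ∀ c e d → c * e * d ≡ e * (c * d)
      lemma = solve-∀
      minor-step : ∀ s → c ^ m * detMinor s ≡ c * c * det (minor B s)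
      minor-step s = begin
        c ^ m * detMinor s   ≡⟨ cong (λ x → x ^ m * detMinor s) c′≡c ⟨
        c′ ^ m * detMinor s  ≡⟨ det-schur (minor A (inject₂ s)) (skewPivot-minor s P) ⟩
        c′ * c′ * det (schurComplement (minor A (inject₂ s)))
          ≡⟨ cong₂ (λ x d → x * x * d) c′≡c (det-cong (schurComplement-minor {A = A} s)) ⟩
        c * c * det (minor B s) ∎
        where
          c′ = minor A (inject₂ s) pivot₀ pivot₁
          c′≡c : c′ ≡ c
          c′≡c = cong (A pivot₀) (punchIn-inject₂-pivot₁ s)
      column : ∀ s → c ^ m * term s (detMinor s) ≡ c * c * term s (det (minor B s))
      column s = trans (shuffle (c ^ m) (signFin s) (B zero s) _)
                       (trans (cong (term s) (minor-step s)) (sym (shuffle (c * c) (signFin s) (B zero s) _)))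
        where shuffle : ∀ k σ b d → k * (σ * (b * d)) ≡ σ * (b * (k * d))
              shuffle = solve-∀

module OddSkewSymmetric where

  open Determinant using (x≡-x⇒x≡0)
  open SchurComplement
  open import Data.Nat.Base using (ℕ; zero; suc; z≤n; s≤s)
  open import Data.Nat.Divisibility using (_∣_; ∣1⇒≡1; ∣m+n∣m⇒∣n; ∣-refl)
  open import Data.Integer.Base
    using (ℤ; +_; -_; _+_; _-_; _*_; _^_; 0ℤ; 1ℤ; +0; +[1+_]; -[1+_]; _<_; +<+; positive; nonNegative)
  open import Data.Integer.Properties using (*-zeroʳ; *-assoc; <⇒≤; *-monoˡ-<-pos; *-cancelˡ-<-nonNeg)
  open import Data.Integer.Tactic.RingSolver using (solve-∀)
  open import Data.Product.Base using (∃; _,_)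
  open import Function.Base using (_∘_)
  open import Relation.Binary.PropositionalEquality
  open import Relation.Nullary.Negation using (contradiction)

  private variable
    n m : ℕ
    x y z : ℤ

  IsSkewSymmetric : Matrix n → Set
  IsSkewSymmetric A = ∀ i j → A j i ≡ - A i j

  Odd : ℤ → Set
  Odd x = ∃ λ k → x ≡ 1ℤ + + 2 * k

  OddOffDiagonal : Matrix n → Set
  OddOffDiagonal A = ∀ i j → i ≢ j → Odd (A i j)

  odd-* : Odd x → Odd y → Odd (x * y)
  odd-* (a , refl) (b , refl) = a + b + + 2 * a * b , lemma a b
    where lemma : ∀ a b → (1ℤ + + 2 * a) * (1ℤ + + 2 * b) ≡ 1ℤ + + 2 * (a + b + + 2 * a * b)
          lemma = solve-∀

  odd-neg : Odd x → Odd (- x)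
  odd-neg (a , refl) = - 1ℤ - a , lemma a
    where lemma : ∀ a → - (1ℤ + + 2 * a) ≡ 1ℤ + + 2 * (- 1ℤ - a)
          lemma = solve-∀

  odd-+₃ : Odd x → Odd y → Odd z → Odd (x + y + z)
  odd-+₃ (a , refl) (b , refl) (c , refl) = 1ℤ + a + b + c , lemma a b c
    where lemma : ∀ a b c → 1ℤ + + 2 * a + (1ℤ + + 2 * b) + (1ℤ + + 2 * c) ≡ 1ℤ + + 2 * (1ℤ + a + b + c)
          lemma = solve-∀

  odd⇒≢0 : Odd x → x ≢ 0ℤ
  odd⇒≢0 (+ zero           , ()) refl
  odd⇒≢0 (+[1+ _ ]         , ()) refl
  odd⇒≢0 (-[1+ zero ]      , ()) refl
  odd⇒≢0 (-[1+ suc _ ]     , ()) refl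

  skew⇒skewPivot : {A : Matrix (suc (suc m))} → IsSkewSymmetric A → SkewPivot A
  skew⇒skewPivot skew = record
    { zero₀ = x≡-x⇒x≡0 (skew pivot₀ pivot₀)
    ; zero₁ = x≡-x⇒x≡0 (skew pivot₁ pivot₁)
    ; anti  = skew pivot₀ pivot₁
    }

  schurComplement-skew : {A : Matrix (suc (suc m))} → IsSkewSymmetric A → IsSkewSymmetric (schurComplement A)
  schurComplement-skew {A = A} skew r s =
    antisym (A pivot₀ pivot₁) (A r′ s′) (A r′ pivot₁) (A r′ pivot₀) (A pivot₁ s′) (A pivot₀ s′)
            (skew r′ s′) (skew pivot₁ s′) (skew r′ pivot₀) (skew pivot₀ s′) (skew r′ pivot₁)
    where
      r′ = inject₂ r
      s′ = inject₂ s
      antisym : ∀ {yx yq px yp qx} c xy xq xp qy py →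
        yx ≡ - xy → yq ≡ - qy → px ≡ - xp → yp ≡ - py → qx ≡ - xq →
        c * yx + (- yq) * px + yp * qx ≡ - (c * xy + (- xq) * py + xp * qy)
      antisym c xy xq xp qy py refl refl refl refl refl = ring c xy xq xp qy py
        where ring : ∀ c xy xq xp qy py →
                c * (- xy) + (- (- qy)) * (- xp) + (- py) * (- xq) ≡ - (c * xy + (- xq) * py + xp * qy)
              ring = solve-∀

  schurComplement-odd : {A : Matrix (suc (suc m))} → OddOffDiagonal A → OddOffDiagonal (schurComplement A)
  schurComplement-odd odd r s r≢s = odd-+₃
    (odd-* (odd _ _ pivot₀≢pivot₁) (odd _ _ (r≢s ∘ inject₂-injective)))
    (odd-* (odd-neg (odd _ _ (inject₂≢pivot₁ r))) (odd _ _ (inject₂≢pivot₀ s ∘ sym)))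
    (odd-* (odd _ _ (inject₂≢pivot₀ r)) (odd _ _ (inject₂≢pivot₁ s ∘ sym)))

  square-pos : x ≢ 0ℤ → 0ℤ < x * x
  square-pos {+0}       x≢0 = contradiction refl x≢0
  square-pos {+[1+ _ ]} _   = +<+ (s≤s z≤n)
  square-pos { -[1+ _ ]} _  = +<+ (s≤s z≤n)

  pos-* : 0ℤ < x → 0ℤ < y → 0ℤ < x * y
  pos-* {x} 0<x 0<y = subst (_< x * _) (*-zeroʳ x) (*-monoˡ-<-pos x {{positive 0<x}} 0<y)

  pos-cancelˡ : 0ℤ < x → 0ℤ < x * y → 0ℤ < y
  pos-cancelˡ {x} 0<x 0<xy =
    *-cancelˡ-<-nonNeg x {{nonNegative (<⇒≤ 0<x)}} (subst (_< x * _) (sym (*-zeroʳ x)) 0<xy)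

  ^-even-pos : x ≢ 0ℤ → 2 ∣ m → 0ℤ < x ^ m
  ^-even-pos {m = zero}        _   _   = +<+ (s≤s z≤n)
  ^-even-pos {m = suc zero}    _   2∣1 = contradiction (∣1⇒≡1 2∣1) λ ()
  ^-even-pos {x} {suc (suc m)} x≢0 2∣m+2 =
    subst (0ℤ <_) (*-assoc x x (x ^ m)) (pos-* (square-pos x≢0) (^-even-pos x≢0 (∣m+n∣m⇒∣n 2∣m+2 ∣-refl)))

  det-pos : 2 ∣ n → (A : Matrix n) → IsSkewSymmetric A → OddOffDiagonal A → 0ℤ < det A
  det-pos {zero}        _   _ _ _ = +<+ (s≤s z≤n)
  det-pos {suc zero}    2∣1 _ _ _ = contradiction (∣1⇒≡1 2∣1) λ ()
  det-pos {suc (suc m)} 2∣m+2 A skew odd = pos-cancelˡ (^-even-pos c≢0 2∣m) 0<cᵐ*detA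
    where
      2∣m = ∣m+n∣m⇒∣n 2∣m+2 ∣-refl
      c≢0 = odd⇒≢0 (odd pivot₀ pivot₁ pivot₀≢pivot₁)
      0<detB : 0ℤ < det (schurComplement A)
      0<detB = det-pos 2∣m (schurComplement A) (schurComplement-skew skew) (schurComplement-odd odd)
      0<cᵐ*detA : 0ℤ < A pivot₀ pivot₁ ^ m * det A
      0<cᵐ*detA = subst (0ℤ <_) (sym (det-schur A (skew⇒skewPivot skew))) (pos-* (square-pos c≢0) 0<detB)

module SeidelMatrix where

  open OddSkewSymmetric using (IsSkewSymmetric; Odd; OddOffDiagonal; det-pos)
  open import Data.Nat.Base using (ℕ)
  open import Data.Nat.Divisibility using (_∣_)
  open import Data.Fin.Base using (Fin)
  open import Data.Fin.Properties using (_≟_)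
  open import Data.Bool.Base using (Bool; true; false; not)
  open import Data.Product.Base using (_,_)
  open import Data.Integer.Base using (ℤ; -_; 0ℤ; 1ℤ; -1ℤ; _<_)
  open import Function.Base using (_∘_)
  open import Relation.Binary.PropositionalEquality
  open import Relation.Nullary using (Dec; yes; no)
  open import Relation.Nullary.Negation using (contradiction)

  private variable m n : ℕ

  sgn : Bool → ℤ
  sgn true  = 1ℤ
  sgn false = -1ℤ

  sgn-not : ∀ b → sgn (not b) ≡ - sgn b
  sgn-not true  = refl
  sgn-not false = refl

  module _ (T : Tournament n) where

    seidel-diag : ∀ i → seidel T i i ≡ 0ℤ
    seidel-diag i with i ≟ i
    ... | yes _   = refl
    ... | no i≢i = contradiction refl i≢i

    seidel-off : ∀ {i j} → i ≢ j → seidel T i j ≡ sgn (arc T i j)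
    seidel-off {i} {j} i≢j with i ≟ j
    ... | yes i≡j = contradiction i≡j i≢j
    ... | no _ with arc T i j
    ...   | true  = refl
    ...   | false = refl

    sgn-arc-flip : ∀ {i j} → i ≢ j → sgn (arc T j i) ≡ - sgn (arc T i j)
    sgn-arc-flip {i} {j} i≢j = trans (cong sgn (tourn T i j i≢j)) (sgn-not (arc T i j))

    seidel-skew : IsSkewSymmetric (seidel T)
    seidel-skew i j = skew (i ≟ j)
      where
        skew : Dec (i ≡ j) → seidel T j i ≡ - seidel T i j
        skew (yes refl) = trans (seidel-diag i) (cong -_ (sym (seidel-diag i)))
        skew (no i≢j)  = trans (seidel-off (i≢j ∘ sym)) (trans (sgn-arc-flip i≢j) (cong -_ (sym (seidel-off i≢j))))

    seidel-odd : OddOffDiagonal (seidel T)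
    seidel-odd i j i≢j = subst Odd (sym (seidel-off i≢j)) (sgn-odd (arc T i j))
      where sgn-odd : ∀ b → Odd (sgn b)
            sgn-odd true  = 0ℤ , refl
            sgn-odd false = -1ℤ , refl

  det-seidel-pos : 2 ∣ n → (T : Tournament n) → 0ℤ < det (seidel T)
  det-seidel-pos 2∣n T = det-pos 2∣n (seidel T) (seidel-skew T) (seidel-odd T)

  seidel-embedding : (T : Tournament m) (T′ : Tournament n) (f : Fin m → Fin n) →
    (∀ {i j} → f i ≡ f j → i ≡ j) → (∀ i j → arc T′ (f i) (f j) ≡ arc T i j) →
    ∀ i j → seidel T′ (f i) (f j) ≡ seidel T i j
  seidel-embedding T T′ f f-injective arcs i j = embed (i ≟ j)
    where
      embed : Dec (i ≡ j) → seidel T′ (f i) (f j) ≡ seidel T i j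
      embed (yes refl) = trans (seidel-diag T′ (f i)) (sym (seidel-diag T i))
      embed (no i≢j)  =
        trans (seidel-off T′ (i≢j ∘ f-injective)) (trans (cong sgn (arcs i j)) (sym (seidel-off T i≢j)))

module Extension where

  open Determinant using (det-cong; det-scaleRow₀; det-scaleCol₀)
  open SchurComplement
  open OddSkewSymmetric using (skew⇒skewPivot)
  open SeidelMatrix
  open import Data.Nat.Base using (ℕ; zero; suc; z≤n; s≤s)
  open import Data.Fin.Base using (Fin; zero; suc)
  open import Data.Bool.Base using (Bool; true; false; not)
  open import Data.Bool.Properties using (not-involutive)
  open import Data.Sum.Base using (_⊎_; inj₁; inj₂; map₁)
  open import Data.Integer.Base using (ℤ; +_; -_; _+_; _*_; _^_; 0ℤ; 1ℤ; -1ℤ; _<_; +<+; positive)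
  open import Data.Integer.Properties using (*-identityˡ; *-assoc; ^-zeroˡ; *-monoʳ-<-pos; neg-involutive)
  open import Data.Integer.Tactic.RingSolver using (solve-∀)
  open import Function.Base using (_∘_)
  open import Relation.Binary.PropositionalEquality
  open import Relation.Nullary.Negation using (contradiction)
  open ≡-Reasoning

  private variable n : ℕ

  joinPivots : Fin n ⊎ Fin 2 → Fin (suc (suc n))
  joinPivots (inj₁ i)          = inject₂ i
  joinPivots (inj₂ zero)       = pivot₀
  joinPivots (inj₂ (suc zero)) = pivot₁

  splitPivots : Fin (suc (suc n)) → Fin n ⊎ Fin 2
  splitPivots {zero}  t       = inj₂ t
  splitPivots {suc n} zero    = inj₁ zero
  splitPivots {suc n} (suc x) = map₁ suc (splitPivots x)

  splitPivots-joinPivots : (v : Fin n ⊎ Fin 2) → splitPivots (joinPivots v) ≡ v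
  splitPivots-joinPivots {zero}  (inj₂ zero)       = refl
  splitPivots-joinPivots {zero}  (inj₂ (suc zero)) = refl
  splitPivots-joinPivots {suc n} (inj₁ zero)       = refl
  splitPivots-joinPivots {suc n} (inj₁ (suc i))    = cong (map₁ suc) (splitPivots-joinPivots (inj₁ i))
  splitPivots-joinPivots {suc n} (inj₂ zero)       = cong (map₁ suc) (splitPivots-joinPivots {n} (inj₂ zero))
  splitPivots-joinPivots {suc n} (inj₂ (suc zero)) = cong (map₁ suc) (splitPivots-joinPivots {n} (inj₂ (suc zero)))

  joinPivots-splitPivots : (x : Fin (suc (suc n))) → joinPivots (splitPivots x) ≡ x
  joinPivots-splitPivots {zero}  zero       = refl
  joinPivots-splitPivots {zero}  (suc zero) = refl
  joinPivots-splitPivots {suc n} zero       = refl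
  joinPivots-splitPivots {suc n} (suc x)    =
    trans (joinPivots-map₁-suc (splitPivots x)) (cong suc (joinPivots-splitPivots x))
    where
      joinPivots-map₁-suc : (v : Fin n ⊎ Fin 2) → joinPivots (map₁ suc v) ≡ suc (joinPivots v)
      joinPivots-map₁-suc (inj₁ i)          = refl
      joinPivots-map₁-suc (inj₂ zero)       = refl
      joinPivots-map₁-suc (inj₂ (suc zero)) = refl

  splitPivots-injective : {x y : Fin (suc (suc n))} → splitPivots x ≡ splitPivots y → x ≡ y
  splitPivots-injective {x = x} {y} eq =
    trans (sym (joinPivots-splitPivots x)) (trans (cong joinPivots eq) (joinPivots-splitPivots y))

  module _ (T : Tournament (suc n)) where

    -- The new vertices p = pivot₀ → q = pivot₁ both dominate exactly the vertices
    -- dominating vertex 0, and moreover p → 0 → q.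
    newArc : Fin 2 → Fin (suc n) → Bool
    newArc zero       j = not (arc T zero j)
    newArc (suc zero) j = arc T j zero

    arc⁺ : Fin (suc n) ⊎ Fin 2 → Fin (suc n) ⊎ Fin 2 → Bool
    arc⁺ (inj₁ i)          (inj₁ j)          = arc T i j
    arc⁺ (inj₁ i)          (inj₂ t)          = not (newArc t i)
    arc⁺ (inj₂ t)          (inj₁ j)          = newArc t j
    arc⁺ (inj₂ zero)       (inj₂ zero)       = false
    arc⁺ (inj₂ zero)       (inj₂ (suc zero)) = true
    arc⁺ (inj₂ (suc zero)) (inj₂ zero)       = false
    arc⁺ (inj₂ (suc zero)) (inj₂ (suc zero)) = false

    arc⁺-irrefl : ∀ v → arc⁺ v v ≡ false
    arc⁺-irrefl (inj₁ i)          = irrefl T i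
    arc⁺-irrefl (inj₂ zero)       = refl
    arc⁺-irrefl (inj₂ (suc zero)) = refl

    arc⁺-tourn : ∀ v w → v ≢ w → arc⁺ w v ≡ not (arc⁺ v w)
    arc⁺-tourn (inj₁ i)          (inj₁ j)          v≢w = tourn T i j (v≢w ∘ cong inj₁)
    arc⁺-tourn (inj₁ i)          (inj₂ t)          _   = sym (not-involutive (newArc t i))
    arc⁺-tourn (inj₂ t)          (inj₁ j)          _   = refl
    arc⁺-tourn (inj₂ zero)       (inj₂ zero)       v≢w = contradiction refl v≢w
    arc⁺-tourn (inj₂ zero)       (inj₂ (suc zero)) _   = refl
    arc⁺-tourn (inj₂ (suc zero)) (inj₂ zero)       _   = refl
    arc⁺-tourn (inj₂ (suc zero)) (inj₂ (suc zero)) v≢w = contradiction refl v≢w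

    extend : Tournament (suc (suc (suc n)))
    extend = record
      { arc    = λ x y → arc⁺ (splitPivots x) (splitPivots y)
      ; irrefl = λ x → arc⁺-irrefl (splitPivots x)
      ; tourn  = λ x y x≢y → arc⁺-tourn (splitPivots x) (splitPivots y) (x≢y ∘ splitPivots-injective)
      }

    arc-extend : ∀ v w → arc extend (joinPivots v) (joinPivots w) ≡ arc⁺ v w
    arc-extend v w = cong₂ arc⁺ (splitPivots-joinPivots v) (splitPivots-joinPivots w)

    private
      S  = seidel T
      S′ = seidel extend
      x y : Fin (suc n) → ℤ
      x j = sgn (arc T zero j)
      y j = sgn (arc T j zero)

    weight : Fin (suc n) → ℤ
    weight zero    = + 3
    weight (suc _) = 1ℤ

    seidel-extend-pivots : S′ pivot₀ pivot₁ ≡ 1ℤ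
    seidel-extend-pivots =
      trans (seidel-off extend pivot₀≢pivot₁) (cong sgn (arc-extend (inj₂ zero) (inj₂ (suc zero))))

    seidel-extend-inject₂ : ∀ r s → S′ (inject₂ r) (inject₂ s) ≡ S r s
    seidel-extend-inject₂ =
      seidel-embedding T extend inject₂ inject₂-injective (λ i j → arc-extend (inj₁ i) (inj₁ j))

    seidel-extend-pivot₀ : ∀ j → S′ pivot₀ (inject₂ j) ≡ - x j
    seidel-extend-pivot₀ j =
      trans (seidel-off extend (inject₂≢pivot₀ j ∘ sym))
            (trans (cong sgn (arc-extend (inj₂ zero) (inj₁ j))) (sgn-not (arc T zero j)))

    seidel-extend-pivot₁ : ∀ j → S′ pivot₁ (inject₂ j) ≡ y j
    seidel-extend-pivot₁ j =
      trans (seidel-off extend (inject₂≢pivot₁ j ∘ sym)) (cong sgn (arc-extend (inj₂ (suc zero)) (inj₁ j)))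

    schurComplement-extend : ∀ r s → schurComplement S′ r s ≡ weight r * (weight s * S r s)
    schurComplement-extend r s = trans entries (blocks r s)
      where
        entries : schurComplement S′ r s ≡ 1ℤ * S r s + y r * (- x s) + x r * y s
        entries = cong₂ _+_
          (cong₂ _+_ (cong₂ _*_ seidel-extend-pivots (seidel-extend-inject₂ r s))
                     (cong₂ _*_ (trans (cong -_ S′rq) (neg-involutive (y r))) (seidel-extend-pivot₀ s)))
          (cong₂ _*_ (trans S′rp (neg-involutive (x r))) (seidel-extend-pivot₁ s))
          where
            S′rq = trans (seidel-skew extend pivot₁ (inject₂ r)) (cong -_ (seidel-extend-pivot₁ r))
            S′rp = trans (seidel-skew extend pivot₀ (inject₂ r)) (cong -_ (seidel-extend-pivot₀ r))
        blocks : ∀ r s → 1ℤ * S r s + y r * (- x s) + x r * y s ≡ weight r * (weight s * S r s)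
        blocks zero    zero    rewrite irrefl T zero | seidel-diag T zero = refl
        blocks zero    (suc s) rewrite irrefl T zero = row₀ (seidel-off T (λ ())) (sgn-arc-flip T (λ ()))
          where row₀ : ∀ {a b c} → a ≡ b → c ≡ - b → 1ℤ * a + -1ℤ * (- b) + -1ℤ * c ≡ + 3 * (1ℤ * a)
                row₀ {b = b} refl refl = ring b
                  where ring : ∀ b → 1ℤ * b + -1ℤ * (- b) + -1ℤ * (- b) ≡ + 3 * (1ℤ * b)
                        ring = solve-∀
        blocks (suc r) zero    rewrite irrefl T zero = col₀ (seidel-off T (λ ())) (sgn-arc-flip T (λ ()))
          where col₀ : ∀ {a b c} → a ≡ b → c ≡ - b → 1ℤ * a + b * (- -1ℤ) + c * -1ℤ ≡ 1ℤ * (+ 3 * a)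
                col₀ {b = b} refl refl = ring b
                  where ring : ∀ b → 1ℤ * b + b * (- -1ℤ) + (- b) * -1ℤ ≡ 1ℤ * (+ 3 * b)
                        ring = solve-∀
        blocks (suc r) (suc s) = inner (sgn-arc-flip T (λ ())) (sgn-arc-flip T (λ ()))
          where inner : ∀ {a yr ys xr xs} → yr ≡ - xr → ys ≡ - xs →
                          1ℤ * a + yr * (- xs) + xr * ys ≡ 1ℤ * (1ℤ * a)
                inner {a} {xr = xr} {xs} refl refl = ring a xr xs
                  where ring : ∀ a xr xs → 1ℤ * a + (- xr) * (- xs) + xr * (- xs) ≡ 1ℤ * (1ℤ * a)
                        ring = solve-∀

    det-extend : det S′ ≡ + 3 * (+ 3 * det S)
    det-extend = begin
      det S′                             ≡⟨ *-identityˡ (det S′) ⟨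
      1ℤ * det S′                        ≡⟨ cong (_* det S′) (^-zeroˡ (suc n)) ⟨
      1ℤ ^ suc n * det S′                ≡⟨ cong (λ c → c ^ suc n * det S′) seidel-extend-pivots ⟨
      S′ pivot₀ pivot₁ ^ suc n * det S′  ≡⟨ det-schur S′ (skew⇒skewPivot (seidel-skew extend)) ⟩
      S′ pivot₀ pivot₁ * S′ pivot₀ pivot₁ * det (schurComplement S′)
        ≡⟨ cong₂ (λ c d → c * c * d) seidel-extend-pivots (det-cong schurComplement-extend) ⟩
      1ℤ * 1ℤ * det scaledBoth           ≡⟨ *-identityˡ (det scaledBoth) ⟩
      det scaledBoth
        ≡⟨ det-scaleRow₀ (+ 3) {scaledBoth} {scaledCol} (λ _ → refl) (λ _ _ → *-identityˡ _) ⟩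
      + 3 * det scaledCol
        ≡⟨ cong (_*_ (+ 3)) (det-scaleCol₀ (+ 3) {scaledCol} {S} (λ _ → refl) (λ _ _ → *-identityˡ _)) ⟩
      + 3 * (+ 3 * det S)                ∎
      where
        scaledCol scaledBoth : Matrix (suc n)
        scaledCol  r s = weight s * S r s
        scaledBoth r s = weight r * scaledCol r s

  <-ninefold : {z : ℤ} → 0ℤ < z → z < + 3 * (+ 3 * z)
  <-ninefold {z} 0<z =
    subst₂ _<_ (*-identityˡ z) (*-assoc (+ 3) (+ 3) z)
               (*-monoʳ-<-pos z {{positive 0<z}} {1ℤ} {+ 9} (+<+ (s≤s (s≤s z≤n))))

open import Data.Nat using (ℕ; _+_; _<_)
open import Data.Nat.Divisibility using (_∣_)
open import Data.Integer using () renaming (_<_ to _<ℤ_)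
open import Data.Product using (∃)
open import Data.Nat using (zero; suc)
open import Data.Nat.Properties using (+-comm)
open import Data.Product using (_,_)
open import Relation.Binary.PropositionalEquality using (subst; sym)
open SeidelMatrix using (det-seidel-pos)
open Extension using (extend; det-extend; <-ninefold)

corollary2p5 : (n : ℕ) → 0 < n → 2 ∣ n → (T : Tournament n)
    → ∃ λ (T′ : Tournament (n + 2)) → det (seidel T) <ℤ det (seidel T′)
corollary2p5 zero    ()
corollary2p5 (suc n) _  2∣n T rewrite +-comm n 2 =
  extend T , subst (det (seidel T) <ℤ_) (sym (det-extend T)) (<-ninefold (det-seidel-pos 2∣n T))
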